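{- Let $\mathcal{A}\subseteq\{\mathsf{N},\mathsf{M},\mathsf{C}\}$. If a linear nested sequent consisting of a single component $\Gamma\Rightarrow\Delta$ is derivable in $\mathsf{LNS}_{\mathsf{E}\mathcal{A}}$ extended with the contraction rules, then it is derivable in the end-active variant of $\mathsf{LNS}_{\mathsf{E}\mathcal{A}}$ extended with the contraction rules.
   Context: Formulas: propositional variables, $\bot,\top,\neg,\land,\lor,\to,\Box$. Structures: $\mathcal{X}::=\Gamma\Rightarrow\Delta\mid\Gamma\Rightarrow\Delta\,/_{\mathsf e}(\Sigma\Rightarrow\Pi;\Omega\Rightarrow\Theta)\mid\Gamma\Rightarrow\Delta\,/\,\mathcal{X}$ with finite multisets of formulas (components); $\mathcal{S}\{\Gamma\Rightarrow\Delta\}$ has a distinguished component, $\mathcal{G}/\Gamma\Rightarrow\Delta$ has last component $\Gamma\Rightarrow\Delta$. $\mathsf{LNS}_{\mathsf{E}\mathcal{A}}$: propositional rules (zero-premiss $\mathcal{S}\{\Gamma,p\Rightarrow p,\Delta\}$ with $p$ atomic, $\mathcal{S}\{\Gamma,\bot\Rightarrow\Delta\}$, $\mathcal{S}\{\Gamma\Rightarrow\top,\Delta\}$, and the standard two-sided invertible rules for $\neg,\land,\lor,\to$ on one component), not applicable to sequents inside $/_{\mathsf e}$; $\Box^{\mathsf e}_R$: $\mathcal{G}/\Gamma\Rightarrow\Delta/_{\mathsf e}(\Rightarrow B;B\Rightarrow)$ / $\mathcal{G}/\Gamma\Rightarrow\Box B,\Delta$; $\Box^{\mathsf e}_L$: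 $\mathcal{G}/\Gamma\Rightarrow\Delta/\Sigma,A\Rightarrow\Pi$ and $\mathcal{G}/\Gamma\Rightarrow\Delta/\Omega\Rightarrow A,\Theta$ / $\mathcal{G}/\Gamma,\Box A\Rightarrow\Delta/_{\mathsf e}(\Sigma\Rightarrow\Pi;\Omega\Rightarrow\Theta)$; if $\mathsf{N}\in\mathcal{A}$: $\mathcal{G}/\Gamma\Rightarrow\Delta/\Rightarrow B$ / $\mathcal{G}/\Gamma\Rightarrow\Box B,\Delta$; if $\mathsf{M}\in\mathcal{A}$: $\mathcal{G}/_{\mathsf e}(\Sigma\Rightarrow\Pi;\Omega,\bot\Rightarrow\Theta)$ / $\mathcal{G}/_{\mathsf e}(\Sigma\Rightarrow\Pi;\Omega\Rightarrow\Theta)$; if $\mathsf{C}\in\mathcal{A}$: $\mathcal{G}/\Gamma\Rightarrow\Delta/_{\mathsf e}(\Sigma,A\Rightarrow\Pi;\Omega\Rightarrow\Theta)$ and $\mathcal{G}/\Gamma\Rightarrow\Delta/\Omega\Rightarrow A,\Theta$ / $\mathcal{G}/\Gamma,\Box A\Rightarrow\Delta/_{\mathsf e}(\Sigma\Rightarrow\Pi;\Omega\Rightarrow\Theta)$. Contraction: usual left/right rules inside a component. An application of a rule is end-active if the rightmost components of its premisses are active and the only active components (in premisses and conclusion) are the two rightmost ones; the end-active variant of a calculus restricts all rules to end-active applications. -}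

module Defs where

open import Data.Nat using (ℕ)
open import Data.Bool using (Bool; T)
open import Data.List using (List; []; _∷_; _++_; [_])
open import Data.List.Relation.Unary.All using (All)
open import Data.List.Relation.Binary.Pointwise using (Pointwise)
open import Data.List.Relation.Binary.Permutation.Propositional using (_↭_)
open import Data.Product using (_×_; _,_)
open import Data.Sum using (_⊎_)
open import Data.Unit using (⊤)
open import Relation.Binary.PropositionalEquality using (_≡_)

infixr 6 _∧'_
infixr 5 _∨'_
infixr 4 _⇒'_

data Fm : Set where
  var  : ℕ → Fm
  ⊥'   : Fm
  ⊤'   : Fm
  ¬'_  : Fm → Fm
  _∧'_ : Fm → Fm → Fm
  _∨'_ : Fm → Fm → Fm
  _⇒'_ : Fm → Fm → Fm
  □_   : Fm → Fm

-- Sequents (components).  Multisets are lists, identified up to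
-- permutation (see the constructor `perm` of `Der` below).

record Seq : Set where
  constructor _⊢_
  field
    ante : List Fm
    succ : List Fm
open Seq public

-- The right end of a linear nested sequent: either a plain last
-- component Γ ⇒ Δ, or Γ ⇒ Δ /ₑ (Σ ⇒ Π ; Ω ⇒ Θ).
data End : Set where
  plain : Seq → End
  block : Seq → Seq → Seq → End

-- A linear nested sequent  G₁ / … / Gₖ / end   (G may be empty).
record Struct : Set where
  constructor ⟨_∣_⟩
  field
    init : List Seq
    end  : End

-- Contexts S{ } with one distinguished component, which is never
-- inside /ₑ.
data Ctx : Set where
  inInit  : List Seq → List Seq → End → Ctx
  inLast  : List Seq → Ctx
  inLastE : List Seq → Seq → Seq → Ctx

plug : Ctx → Seq → Struct
plug (inInit G₁ G₂ e) s = ⟨ G₁ ++ (s ∷ G₂) ∣ e ⟩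
plug (inLast G)       s = ⟨ G ∣ plain s ⟩
plug (inLastE G s₁ s₂) s = ⟨ G ∣ block s s₁ s₂ ⟩

_≈Seq_ : Seq → Seq → Set
(Γ ⊢ Δ) ≈Seq (Γ' ⊢ Δ') = (Γ ↭ Γ') × (Δ ↭ Δ')

data _≈End_ : End → End → Set where
  plain≈ : ∀ {s s'} → s ≈Seq s' → plain s ≈End plain s'
  block≈ : ∀ {s s' t t' u u'} → s ≈Seq s' → t ≈Seq t' → u ≈Seq u' →
           block s t u ≈End block s' t' u'

_≈_ : Struct → Struct → Set
⟨ G ∣ e ⟩ ≈ ⟨ G' ∣ e' ⟩ = Pointwise _≈Seq_ G G' × (e ≈End e')

data PRule : List Seq → Seq → Set where
  idₚ : ∀ {Γ Δ} p → PRule [] ((var p ∷ Γ) ⊢ (var p ∷ Δ))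
  ⊥L  : ∀ {Γ Δ} → PRule [] ((⊥' ∷ Γ) ⊢ Δ)
  ⊤R  : ∀ {Γ Δ} → PRule [] (Γ ⊢ (⊤' ∷ Δ))
  ¬L  : ∀ {Γ Δ A} → PRule [ Γ ⊢ (A ∷ Δ) ] ((¬' A ∷ Γ) ⊢ Δ)
  ¬R  : ∀ {Γ Δ A} → PRule [ (A ∷ Γ) ⊢ Δ ] (Γ ⊢ (¬' A ∷ Δ))
  ∧L  : ∀ {Γ Δ A B} → PRule [ (A ∷ B ∷ Γ) ⊢ Δ ] (((A ∧' B) ∷ Γ) ⊢ Δ)
  ∧R  : ∀ {Γ Δ A B} → PRule ((Γ ⊢ (A ∷ Δ)) ∷ (Γ ⊢ (B ∷ Δ)) ∷ []) (Γ ⊢ ((A ∧' B) ∷ Δ))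
  ∨L  : ∀ {Γ Δ A B} → PRule (((A ∷ Γ) ⊢ Δ) ∷ ((B ∷ Γ) ⊢ Δ) ∷ []) (((A ∨' B) ∷ Γ) ⊢ Δ)
  ∨R  : ∀ {Γ Δ A B} → PRule [ Γ ⊢ (A ∷ B ∷ Δ) ] (Γ ⊢ ((A ∨' B) ∷ Δ))
  ⇒L  : ∀ {Γ Δ A B} → PRule ((Γ ⊢ (A ∷ Δ)) ∷ ((B ∷ Γ) ⊢ Δ) ∷ []) (((A ⇒' B) ∷ Γ) ⊢ Δ)
  ⇒R  : ∀ {Γ Δ A B} → PRule [ (A ∷ Γ) ⊢ (B ∷ Δ) ] (Γ ⊢ ((A ⇒' B) ∷ Δ))
  conL : ∀ {Γ Δ A} → PRule [ (A ∷ A ∷ Γ) ⊢ Δ ] ((A ∷ Γ) ⊢ Δ)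
  conR : ∀ {Γ Δ A} → PRule [ Γ ⊢ (A ∷ A ∷ Δ) ] (Γ ⊢ (A ∷ Δ))

record Axioms : Set where
  field
    hasN : Bool
    hasM : Bool
    hasC : Bool
open Axioms public

data Mode : Set where
  full endActive : Mode

-- With at least one premiss: end-active iff the active component is the
-- rightmost one (a plain last component).
-- Zero premisses: end-active iff the active component of the conclusion
-- is one of the two rightmost components (the /ₑ-block counts as one
-- component).
data EndActive≥1 : Ctx → Set where
  last : ∀ G → EndActive≥1 (inLast G)

data EndActive0 : Ctx → Set where
  last  : ∀ G → EndActive0 (inLast G)
  lastE : ∀ G s₁ s₂ → EndActive0 (inLastE G s₁ s₂)
  penult : ∀ G s → EndActive0 (inInit G [] (plain s))

Allowed : Mode → List Seq → Ctx → Set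
Allowed full      _       _ = ⊤
Allowed endActive []      C = EndActive0 C
Allowed endActive (_ ∷ _) C = EndActive≥1 C

-- Derivability in LNS_{E𝒜} + contraction (mode full) and in its
-- end-active variant (mode endActive).  All modal rules, as given,
-- operate on the two rightmost components and are end-active.

data Der (m : Mode) (𝒜 : Axioms) : Struct → Set where
  perm : ∀ {X Y} → Der m 𝒜 X → X ≈ Y → Der m 𝒜 Y
  prop : ∀ {ps c} (C : Ctx) → Allowed m ps C → PRule ps c →
         All (λ s → Der m 𝒜 (plug C s)) ps → Der m 𝒜 (plug C c)
  □Rᵉ  : ∀ {G Γ Δ B} →
         Der m 𝒜 ⟨ G ∣ block (Γ ⊢ Δ) ([] ⊢ [ B ]) ([ B ] ⊢ []) ⟩ →
         Der m 𝒜 ⟨ G ∣ plain (Γ ⊢ (□ B ∷ Δ)) ⟩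
  □Lᵉ  : ∀ {G Γ Δ Σ Π Ω Θ A} →
         Der m 𝒜 ⟨ G ++ [ Γ ⊢ Δ ] ∣ plain ((A ∷ Σ) ⊢ Π) ⟩ →
         Der m 𝒜 ⟨ G ++ [ Γ ⊢ Δ ] ∣ plain (Ω ⊢ (A ∷ Θ)) ⟩ →
         Der m 𝒜 ⟨ G ∣ block ((□ A ∷ Γ) ⊢ Δ) (Σ ⊢ Π) (Ω ⊢ Θ) ⟩
  ruleN : ∀ {G Γ Δ B} → T (hasN 𝒜) →
         Der m 𝒜 ⟨ G ++ [ Γ ⊢ Δ ] ∣ plain ([] ⊢ [ B ]) ⟩ →
         Der m 𝒜 ⟨ G ∣ plain (Γ ⊢ (□ B ∷ Δ)) ⟩
  ruleM : ∀ {G s Σ Π Ω Θ} → T (hasM 𝒜) →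
         Der m 𝒜 ⟨ G ∣ block s (Σ ⊢ Π) ((⊥' ∷ Ω) ⊢ Θ) ⟩ →
         Der m 𝒜 ⟨ G ∣ block s (Σ ⊢ Π) (Ω ⊢ Θ) ⟩
  ruleC : ∀ {G Γ Δ Σ Π Ω Θ A} → T (hasC 𝒜) →
         Der m 𝒜 ⟨ G ∣ block (Γ ⊢ Δ) ((A ∷ Σ) ⊢ Π) (Ω ⊢ Θ) ⟩ →
         Der m 𝒜 ⟨ G ++ [ Γ ⊢ Δ ] ∣ plain (Ω ⊢ (A ∷ Θ)) ⟩ →
         Der m 𝒜 ⟨ G ∣ block ((□ A ∷ Γ) ⊢ Δ) (Σ ⊢ Π) (Ω ⊢ Θ) ⟩

-- Read a linear nested sequent as the disjunction of its components, the final
-- Γ ⇒ Δ /ₑ (Σ ⇒ Π ; Ω ⇒ Θ) being the single sequent Γ ⇒ Δ with a pending block.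
-- The block is closed by boxes □A, □C₁, …, □Cₖ in Γ once the premisses of one □Lᵉ
-- step and k C steps are derivable (with M, the right premisses come for free).  This
-- yields a calculus SeqDer of single sequents.  Every rule of the full calculus
-- preserves "some component is SeqDer-derivable"; conversely, a SeqDer derivation is
-- replayed on the rightmost component alone (□R opens a block, the closing boxes
-- discharge it by C, M and □Lᵉ), using end-active steps only.  A one-component
-- sequent has no other component, so derivability transfers.
module Submission where

open import Defs
open import Data.Bool using (T)
open import Data.List using (List; []; _∷_; _++_; [_]; map; _ʳ++_)
open import Data.List.Properties using (++-assoc)
open import Data.List.Relation.Unary.All as All using (All; []; _∷_)
open import Data.List.Relation.Unary.Any using (Any; here; there)
import Data.List.Relation.Unary.Any.Properties as Any
import Data.List.Relation.Binary.Pointwise as Pointwise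
open import Data.List.Relation.Binary.Permutation.Propositional
  using (_↭_; ↭-refl; ↭-sym; ↭-trans; ↭-reflexive; prep)
open import Data.List.Relation.Binary.Permutation.Propositional.Properties
  using (shift; ∷↭∷ʳ; ++⁺ʳ; ++-comm)
open import Data.Maybe using (Maybe; nothing; just)
open import Data.Product using (_×_; _,_)
open import Data.Sum as Sum using (_⊎_; inj₁; inj₂)
open import Relation.Binary.PropositionalEquality using (_≡_; refl)

ʳ++⁺ʳ : ∀ {A : Set} (xs : List A) {ys zs} → ys ↭ zs → xs ʳ++ ys ↭ xs ʳ++ zs
ʳ++⁺ʳ []       p = p
ʳ++⁺ʳ (x ∷ xs) p = ʳ++⁺ʳ xs (prep x p)

All-⊎-const : ∀ {A Q : Set} {P : A → Set} {xs} →
              All (λ x → P x ⊎ Q) xs → All P xs ⊎ Q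
All-⊎-const []            = inj₁ []
All-⊎-const (inj₁ p ∷ ps) = Sum.map₁ (p ∷_) (All-⊎-const ps)
All-⊎-const (inj₂ q ∷ _)  = inj₂ q

≈Seq-refl : ∀ {s} → s ≈Seq s
≈Seq-refl = ↭-refl , ↭-refl

infixl 5 _⊕_
_⊕_ : Seq → Seq → Seq
(Γ ⊢ Δ) ⊕ (Γ' ⊢ Δ') = (Γ ++ Γ') ⊢ (Δ ++ Δ')

⊕≈prepend : ∀ Γ Δ Γ' Δ' →
            ((Γ ⊢ Δ) ⊕ (Γ' ⊢ Δ')) ≈Seq ((Γ' ++ Γ) ⊢ (Δ' ++ Δ))
⊕≈prepend Γ Δ Γ' Δ' = ++-comm Γ Γ' , ++-comm Δ Δ'

PRule-weaken : ∀ {ps c} w → PRule ps c → PRule (map (_⊕ w) ps) (c ⊕ w)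
PRule-weaken w (idₚ p) = idₚ p
PRule-weaken w ⊥L      = ⊥L
PRule-weaken w ⊤R      = ⊤R
PRule-weaken w ¬L      = ¬L
PRule-weaken w ¬R      = ¬R
PRule-weaken w ∧L      = ∧L
PRule-weaken w ∧R      = ∧R
PRule-weaken w ∨L      = ∨L
PRule-weaken w ∨R      = ∨R
PRule-weaken w ⇒L      = ⇒L
PRule-weaken w ⇒R      = ⇒R
PRule-weaken w conL    = conL
PRule-weaken w conR    = conR

OpenBlock : Set
OpenBlock = Maybe (Seq × Seq)

boxBlock : Fm → Seq × Seq
boxBlock B = ([] ⊢ [ B ]) , ([ B ] ⊢ [])

-- The C steps are applied outermost first, each pushing its formula onto Σ, so
-- that the □Lᵉ premiss sees C₁ … Cₖ in reverse order.
data Closes (𝒜 : Axioms) (P : Seq → Set) : OpenBlock → List Fm → Set where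
  closes : ∀ {Γ Σ Π Ω Θ} Γ' A Cs → Γ ↭ map □_ Cs ++ (□ A ∷ Γ') →
           P ((A ∷ Cs ʳ++ Σ) ⊢ Π) → Cs ≡ [] ⊎ T (hasC 𝒜) →
           All (λ C → P (Ω ⊢ (C ∷ Θ)) ⊎ T (hasM 𝒜)) (A ∷ Cs) →
           Closes 𝒜 P (just ((Σ ⊢ Π) , (Ω ⊢ Θ))) Γ

data SeqDer (𝒜 : Axioms) : OpenBlock → Seq → Set where
  exchange : ∀ {b s s'} → s ≈Seq s' → SeqDer 𝒜 b s → SeqDer 𝒜 b s'
  rule     : ∀ {b ps c} → PRule ps c → All (SeqDer 𝒜 b) ps → SeqDer 𝒜 b c
  boxR     : ∀ {b Γ Δ B} → SeqDer 𝒜 (just (boxBlock B)) (Γ ⊢ Δ) →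
             SeqDer 𝒜 b (Γ ⊢ (□ B ∷ Δ))
  necR     : ∀ {b Γ Δ B} → T (hasN 𝒜) → SeqDer 𝒜 nothing ([] ⊢ [ B ]) →
             SeqDer 𝒜 b (Γ ⊢ (□ B ∷ Δ))
  close    : ∀ {b Γ Δ} → Closes 𝒜 (SeqDer 𝒜 nothing) b Γ → SeqDer 𝒜 b (Γ ⊢ Δ)

module _ {𝒜 : Axioms} where

  closes-weaken : ∀ {P b Γ} Γw → Closes 𝒜 P b Γ → Closes 𝒜 P b (Γ ++ Γw)
  closes-weaken Γw (closes Γ' A Cs p a c sides) =
    closes (Γ' ++ Γw) A Cs
      (↭-trans (++⁺ʳ Γw p) (↭-reflexive (++-assoc (map □_ Cs) (□ A ∷ Γ') Γw)))
      a c sides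

  closes-resp-≈ : ∀ {P t t' u u' Γ} → (∀ {s s'} → s ≈Seq s' → P s → P s') →
                  t ≈Seq t' → u ≈Seq u' →
                  Closes 𝒜 P (just (t , u)) Γ → Closes 𝒜 P (just (t' , u')) Γ
  closes-resp-≈ resp (pΣ , pΠ) (pΩ , pΘ) (closes Γ' A Cs p a c sides) =
    closes Γ' A Cs p (resp (prep A (ʳ++⁺ʳ Cs pΣ) , pΠ) a) c
      (All.map (λ {C} → Sum.map₁ (resp (pΩ , prep C pΘ))) sides)

  closes-M : ∀ {P t u u' Γ} → T (hasM 𝒜) →
             Closes 𝒜 P (just (t , u)) Γ → Closes 𝒜 P (just (t , u')) Γ
  closes-M m (closes Γ' A Cs p a c sides) =
    closes Γ' A Cs p a c (All.map (λ _ → inj₂ m) sides)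

  closes-C : ∀ {P A Σ Π Ω Θ Γ} → T (hasC 𝒜) → P (Ω ⊢ (A ∷ Θ)) →
             Closes 𝒜 P (just (((A ∷ Σ) ⊢ Π) , (Ω ⊢ Θ))) Γ →
             Closes 𝒜 P (just ((Σ ⊢ Π) , (Ω ⊢ Θ))) (Γ ++ [ □ A ])
  closes-C {A = A} h e (closes Γ' A₀ Cs p a _ (side₀ ∷ sides)) =
    closes Γ' A₀ (A ∷ Cs) (↭-trans (++⁺ʳ [ □ A ] p) (↭-sym (∷↭∷ʳ (□ A) _)))
      a (inj₂ h) (side₀ ∷ inj₁ e ∷ sides)

  Closes₀ : OpenBlock → List Fm → Set
  Closes₀ = Closes 𝒜 (SeqDer 𝒜 nothing)

  mutual
    weaken-along : ∀ {b b' s} w →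
      (∀ {Γ} → Closes₀ b Γ → Closes₀ b' (Γ ++ ante w)) →
      SeqDer 𝒜 b s → SeqDer 𝒜 b' (s ⊕ w)
    weaken-along w f (exchange (p , q) d) =
      exchange (++⁺ʳ _ p , ++⁺ʳ _ q) (weaken-along w f d)
    weaken-along w f (rule r ds)          = rule (PRule-weaken w r) (weaken-along-all w f ds)
    weaken-along w f (boxR d)             = boxR (weaken-along w (closes-weaken (ante w)) d)
    weaken-along w f (necR n d)           = necR n d
    weaken-along w f (close c)            = close (f c)

    weaken-along-all : ∀ {b b' ps} w →
      (∀ {Γ} → Closes₀ b Γ → Closes₀ b' (Γ ++ ante w)) →
      All (SeqDer 𝒜 b) ps → All (SeqDer 𝒜 b') (map (_⊕ w) ps)
    weaken-along-all w f []       = []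
    weaken-along-all w f (d ∷ ds) = weaken-along w f d ∷ weaken-along-all w f ds

  relocate : ∀ {b b' s} →
    (∀ {Γ} → Closes₀ b Γ → Closes₀ b' Γ) →
    SeqDer 𝒜 b s → SeqDer 𝒜 b' s
  relocate f d =
    exchange (⊕≈prepend _ _ [] [])
      (weaken-along ([] ⊢ []) (λ c → closes-weaken [] (f c)) d)

  weaken-front : ∀ {b Γ Δ} Γ' Δ' → SeqDer 𝒜 nothing (Γ ⊢ Δ) →
                 SeqDer 𝒜 b ((Γ' ++ Γ) ⊢ (Δ' ++ Δ))
  weaken-front Γ' Δ' d =
    exchange (⊕≈prepend _ _ Γ' Δ') (weaken-along (Γ' ⊢ Δ') (λ ()) d)

  SeqDer-ruleC : ∀ {A Σ Π Ω Θ Γ Δ} → T (hasC 𝒜) → SeqDer 𝒜 nothing (Ω ⊢ (A ∷ Θ)) →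
                 SeqDer 𝒜 (just (((A ∷ Σ) ⊢ Π) , (Ω ⊢ Θ))) (Γ ⊢ Δ) →
                 SeqDer 𝒜 (just ((Σ ⊢ Π) , (Ω ⊢ Θ))) ((□ A ∷ Γ) ⊢ Δ)
  SeqDer-ruleC {A} {Γ = Γ} {Δ} h e d =
    exchange (⊕≈prepend Γ Δ [ □ A ] []) (weaken-along ([ □ A ] ⊢ []) (closes-C h e) d)

  HoldsEnd : End → Set
  HoldsEnd (plain s)     = SeqDer 𝒜 nothing s
  HoldsEnd (block s t u) = SeqDer 𝒜 (just (t , u)) s

  Holds : Struct → Set
  Holds ⟨ G ∣ e ⟩ = Any (SeqDer 𝒜 nothing) G ⊎ HoldsEnd e

  Holds-resp-≈ : ∀ {X Y} → X ≈ Y → Holds X → Holds Y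
  Holds-resp-≈ (Gs , _) (inj₁ a) = inj₁ (Pointwise.Any-resp-Pointwise exchange Gs a)
  Holds-resp-≈ (_ , plain≈ q) (inj₂ d) = inj₂ (exchange q d)
  Holds-resp-≈ (_ , block≈ q qt qu) (inj₂ d) =
    inj₂ (exchange q (relocate (closes-resp-≈ exchange qt qu) d))

  blockAt : Ctx → OpenBlock
  blockAt (inInit _ _ _)  = nothing
  blockAt (inLast _)      = nothing
  blockAt (inLastE _ t u) = just (t , u)

  Rest : Ctx → Set
  Rest (inInit G₁ G₂ e) =
    Any (SeqDer 𝒜 nothing) G₁ ⊎ Any (SeqDer 𝒜 nothing) G₂ ⊎ HoldsEnd e
  Rest (inLast G)       = Any (SeqDer 𝒜 nothing) G
  Rest (inLastE G _ _)  = Any (SeqDer 𝒜 nothing) G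

  focus : ∀ C {s} → Holds (plug C s) → SeqDer 𝒜 (blockAt C) s ⊎ Rest C
  focus (inInit G₁ _ _) (inj₁ a) with Any.++⁻ G₁ a
  ... | inj₁ a₁         = inj₂ (inj₁ a₁)
  ... | inj₂ (here d)   = inj₁ d
  ... | inj₂ (there a₂) = inj₂ (inj₂ (inj₁ a₂))
  focus (inInit _ _ _) (inj₂ h) = inj₂ (inj₂ (inj₂ h))
  focus (inLast _)      = Sum.swap
  focus (inLastE _ _ _) = Sum.swap

  unfocus : ∀ C {s} → SeqDer 𝒜 (blockAt C) s ⊎ Rest C → Holds (plug C s)
  unfocus (inInit G₁ _ _) (inj₁ d)                = inj₁ (Any.++⁺ʳ G₁ (here d))
  unfocus (inInit _ _ _)  (inj₂ (inj₁ a))         = inj₁ (Any.++⁺ˡ a)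
  unfocus (inInit G₁ _ _) (inj₂ (inj₂ (inj₁ a)))  = inj₁ (Any.++⁺ʳ G₁ (there a))
  unfocus (inInit _ _ _)  (inj₂ (inj₂ (inj₂ h)))  = inj₂ h
  unfocus (inLast _)      = Sum.swap
  unfocus (inLastE _ _ _) = Sum.swap

  rule-sound : ∀ C {ps c} → PRule ps c →
               All (λ s → Holds (plug C s)) ps → Holds (plug C c)
  rule-sound C r hs = unfocus C (Sum.map₁ (rule r) (All-⊎-const (All.map (focus C) hs)))

  Holds-snoc : ∀ G {s s'} → Holds ⟨ G ++ [ s ] ∣ plain s' ⟩ →
               Any (SeqDer 𝒜 nothing) G ⊎ SeqDer 𝒜 nothing s ⊎ SeqDer 𝒜 nothing s'
  Holds-snoc G h with focus (inInit G [] (plain _)) h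
  ... | inj₁ d                = inj₂ (inj₁ d)
  ... | inj₂ (inj₁ a)         = inj₁ a
  ... | inj₂ (inj₂ (inj₂ d')) = inj₂ (inj₂ d')

  mutual
    sound : ∀ {X} → Der full 𝒜 X → Holds X
    sound (perm d eq)     = Holds-resp-≈ eq (sound d)
    sound (prop C _ r ds) = rule-sound C r (sound-all ds)
    sound (□Rᵉ d)         = Sum.map₂ boxR (sound d)
    sound (□Lᵉ {G} d₁ d₂) with Holds-snoc G (sound d₁) | Holds-snoc G (sound d₂)
    ... | inj₁ a          | _                = inj₁ a
    ... | inj₂ (inj₁ γ)   | _                = inj₂ (weaken-front [ □ _ ] [] γ)
    ... | _               | inj₁ a           = inj₁ a
    ... | _               | inj₂ (inj₁ γ)    = inj₂ (weaken-front [ □ _ ] [] γ)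
    ... | inj₂ (inj₂ dl)  | inj₂ (inj₂ dr)   =
      inj₂ (close (closes _ _ [] ↭-refl dl (inj₁ refl) (inj₁ dr ∷ [])))
    sound (ruleN {G} n d) with Holds-snoc G (sound d)
    ... | inj₁ a          = inj₁ a
    ... | inj₂ (inj₁ γ)   = inj₂ (weaken-front [] [ □ _ ] γ)
    ... | inj₂ (inj₂ dB)  = inj₂ (necR n dB)
    sound (ruleM m d)     = Sum.map₂ (relocate (closes-M m)) (sound d)
    sound (ruleC {G} h d₁ d₂) with Holds-snoc G (sound d₂)
    ... | inj₁ a          = inj₁ a
    ... | inj₂ (inj₁ γ)   = inj₂ (weaken-front [ □ _ ] [] γ)
    ... | inj₂ (inj₂ e)   = Sum.map₂ (SeqDer-ruleC h e) (sound d₁)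

    sound-all : ∀ {C ps} → All (λ s → Der full 𝒜 (plug C s)) ps →
                All (λ s → Holds (plug C s)) ps
    sound-all []       = []
    sound-all (d ∷ ds) = sound d ∷ sound-all ds

  -- Independence of the history G is needed because every modal rule pushes the
  -- current component onto it.
  Derivable : Seq → Set
  Derivable s = ∀ G → Der endActive 𝒜 ⟨ G ∣ plain s ⟩

  ⊥L-derivable : ∀ {Γ Δ} → Derivable ((⊥' ∷ Γ) ⊢ Δ)
  ⊥L-derivable G = prop (inLast G) (last G) ⊥L []

  perm-plain : ∀ {G s s'} → s ≈Seq s' →
               Der endActive 𝒜 ⟨ G ∣ plain s ⟩ →
               Der endActive 𝒜 ⟨ G ∣ plain s' ⟩
  perm-plain q d = perm d (Pointwise.refl ≈Seq-refl , plain≈ q)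

  perm-blockˡ : ∀ {G Γ Γ' Δ t u} → Γ ↭ Γ' →
                Der endActive 𝒜 ⟨ G ∣ block (Γ ⊢ Δ) t u ⟩ →
                Der endActive 𝒜 ⟨ G ∣ block (Γ' ⊢ Δ) t u ⟩
  perm-blockˡ p d =
    perm d (Pointwise.refl ≈Seq-refl , block≈ (p , ↭-refl) ≈Seq-refl ≈Seq-refl)

  close-by-boxes : ∀ {G Γ Δ Σ Π Ω Θ} A Cs → Cs ≡ [] ⊎ T (hasC 𝒜) →
    Derivable ((A ∷ Cs ʳ++ Σ) ⊢ Π) →
    All (λ C → Derivable (Ω ⊢ (C ∷ Θ))) (A ∷ Cs) →
    Der endActive 𝒜 ⟨ G ∣ block ((map □_ Cs ++ (□ A ∷ Γ)) ⊢ Δ) (Σ ⊢ Π) (Ω ⊢ Θ) ⟩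
  close-by-boxes A []       _        a (e ∷ [])     = □Lᵉ (a _) (e _)
  close-by-boxes A (_ ∷ _)  (inj₁ ())
  close-by-boxes A (C ∷ Cs) (inj₂ h) a (e ∷ f ∷ es) =
    ruleC h (close-by-boxes A Cs (inj₂ h) a (e ∷ es)) (f _)

  close-block : ∀ {t u Γ Δ} → Closes 𝒜 Derivable (just (t , u)) Γ →
                ∀ G → Der endActive 𝒜 ⟨ G ∣ block (Γ ⊢ Δ) t u ⟩
  close-block (closes _ A Cs p a c sides) G with All-⊎-const sides
  ... | inj₁ ds = perm-blockˡ (↭-sym p) (close-by-boxes A Cs c a ds)
  ... | inj₂ m  = perm-blockˡ (↭-sym p)
    (ruleM m (close-by-boxes A Cs c a (All.universal (λ _ → ⊥L-derivable) _)))

  allowed-last : ∀ ps G → Allowed endActive ps (inLast G)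
  allowed-last []      G = last G
  allowed-last (_ ∷ _) G = last G

  -- W is the part of the succedent carried along; under a pending box block it starts
  -- with the □B whose □Rᵉ step opened the block.
  data Opened : OpenBlock → List Fm → Set where
    root  : ∀ {W} → Opened nothing W
    byBox : ∀ {B W} → Opened (just (boxBlock B)) (□ B ∷ W)

  mutual
    complete : ∀ {b W s} → SeqDer 𝒜 b s → Opened b W → Derivable (s ⊕ ([] ⊢ W))
    complete (exchange (p , q) d) o G = perm-plain (++⁺ʳ [] p , ++⁺ʳ _ q) (complete d o G)
    complete (rule r ds) o G =
      prop (inLast G) (allowed-last _ G) (PRule-weaken _ r) (complete-all ds o G)
    complete {W = W} (boxR {Δ = Δ} {B} d) o G =
      perm-plain (↭-refl , shift (□ B) Δ W) (complete d byBox G)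
    complete (necR n d) o G = ruleN n (complete₀ d _)
    complete (close ()) root G
    complete (close {Δ = Δ} c) (byBox {B} {W}) G =
      perm-plain (↭-refl , ↭-sym (shift (□ B) Δ W))
        (□Rᵉ (close-block (closes-weaken [] (complete-closes c)) G))

    complete-all : ∀ {b W ps} → All (SeqDer 𝒜 b) ps → Opened b W →
      ∀ G → All (λ s → Der endActive 𝒜 (plug (inLast G) s)) (map (_⊕ ([] ⊢ W)) ps)
    complete-all []       o G = []
    complete-all (d ∷ ds) o G = complete d o G ∷ complete-all ds o G

    complete₀ : ∀ {s} → SeqDer 𝒜 nothing s → Derivable s
    complete₀ d G = perm-plain (⊕≈prepend _ _ [] []) (complete d root G)

    complete-closes : ∀ {b Γ} → Closes₀ b Γ → Closes 𝒜 Derivable b Γ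
    complete-closes (closes Γ' A Cs p a c sides) =
      closes Γ' A Cs p (complete₀ a) c (complete-sides sides)

    complete-sides : ∀ {Ω Θ Cs} →
                     All (λ C → SeqDer 𝒜 nothing (Ω ⊢ (C ∷ Θ)) ⊎ T (hasM 𝒜)) Cs →
                     All (λ C → Derivable (Ω ⊢ (C ∷ Θ)) ⊎ T (hasM 𝒜)) Cs
    complete-sides []               = []
    complete-sides (inj₁ d ∷ sides) = inj₁ (complete₀ d) ∷ complete-sides sides
    complete-sides (inj₂ m ∷ sides) = inj₂ m ∷ complete-sides sides

mainTheorem9 : (𝒜 : Axioms) (Γ Δ : List Fm) →
    Der full 𝒜 ⟨ [] ∣ plain (Γ ⊢ Δ) ⟩ →
    Der endActive 𝒜 ⟨ [] ∣ plain (Γ ⊢ Δ) ⟩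
mainTheorem9 𝒜 Γ Δ d with sound d
... | inj₁ ()
... | inj₂ γ = complete₀ γ []
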